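{- Let $\kappa$ be a measurable cardinal and $\mathcal{U}$ a normal measure on $\kappa$. Let $(\mathcal{A},A)\in\mathbb{P}_\mathcal{U}$ and let $X\in\mathrm{id}_{<\omega,\kappa}(\mathcal{A})$. Then $(\mathcal{A},A\setminus X)\in\mathbb{P}_\mathcal{U}$.
   Context: For $\mathcal{A}\subseteq[\kappa]^\kappa$, $\mathrm{FF}_{<\omega,\kappa}(\mathcal{A})$ is the set of finite partial functions $h$ from $\mathcal{A}$ to $\{0,1\}$, and $\mathcal{A}^h=\bigcap_{A'\in\mathrm{dom}(h)}\mathcal{A}^{h(A')}$ where $\mathcal{A}^{h(A')}=A'$ if $h(A')=0$ and $\kappa\setminus A'$ if $h(A')=1$. $\mathcal{A}$ is $\kappa$-independent if every $\mathcal{A}^h$ is unbounded in $\kappa$. $\mathbb{P}_\mathcal{U}$ is the poset of pairs $(\mathcal{A},A)$ where $\mathcal{A}$ is a $\kappa$-independent family of cardinality $\kappa$ and $A\in\mathcal{U}$ is such that $\mathcal{A}^h\cap A$ is unbounded for all $h\in\mathrm{FF}_{<\omega,\kappa}(\mathcal{A})$; $(\mathcal{A}_1,A_1)\le(\mathcal{A}_0,A_0)$ iff $\mathcal{A}_1\supseteq\mathcal{A}_0$ and $|A_1\setminus A_0|<\kappa$. The density ideal $\mathrm{id}_{<\omega,\kappa}(\mathcal{A})$ is the set of all $X\subseteq\kappa$ with $\kappa\setminus X\in\mathcal{U}$ such that for every $h\in\mathrm{FF}_{<\omega,\kappa}(\mathcal{A})$ there is $h'\supseteq h$ in $\mathrm{FF}_{<\omega,\kappa}(\mathcal{A})$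 with $\mathcal{A}^{h'}\cap X=\emptyset$. -}

module Defs where

-- Set-theoretic setting modelled in type theory:
--   * the cardinal κ is a type K with a well-founded strict total order _<_
--     (an ordinal) that is initial (not injectable into a proper initial segment);
--   * subsets of κ are predicates  K → Set;
--   * a family 𝒜 ⊆ [κ]^κ of cardinality κ is an injective enumeration  K → (K → Set).

open import Level using (0ℓ)
open import Data.Nat using (ℕ)
open import Data.Bool using (Bool; true; false)
import Data.Unit
import Data.Sum
open import Data.Empty using (⊥)
open import Data.Product using (Σ; ∃; _×_; _,_; proj₁)
open import Data.List using (List; map)
open import Data.List.Membership.Propositional using (_∈_)
open import Data.List.Relation.Unary.All using (All)
open import Data.List.Relation.Unary.Unique.Propositional using (Unique)
open import Relation.Nullary using (¬_)
open import Relation.Binary.PropositionalEquality using (_≡_)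
open import Relation.Binary.Core using (Rel)
open import Relation.Binary.Structures using (IsStrictTotalOrder)
open import Induction.WellFounded using (WellFounded)
open import Function.Definitions using (Injective; Surjective)
open import Function.Bundles using (_⇔_)

Subset : Set → Set₁
Subset K = K → Set

module _ {K : Set} where

  _⊆_ : Subset K → Subset K → Set
  S ⊆ T = ∀ β → S β → T β

  _∩_ : Subset K → Subset K → Subset K
  (S ∩ T) β = S β × T β

  _∖_ : Subset K → Subset K → Subset K
  (S ∖ T) β = S β × ¬ T β

  ∁ : Subset K → Subset K
  ∁ S β = ¬ S β

  ∅ : Subset K
  ∅ _ = ⊥

module _ {K : Set} (_<_ : Rel K 0ℓ) where

  Seg : K → Set
  Seg α = Σ K (λ β → β < α)

  IsCardinal : Set
  IsCardinal = IsStrictTotalOrder _≡_ _<_ × WellFounded _<_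
             × (∀ α → ¬ (Σ (K → Seg α) (λ f → Injective _≡_ _≡_ f)))

  Uncountable : Set
  Uncountable = ¬ (Σ (ℕ → K) (λ f → Surjective _≡_ _≡_ f))

  SmallerThanκ : Set → Set
  SmallerThanκ I = Σ K (λ α → Σ (I → Seg α) (λ f → Injective _≡_ _≡_ f))

  HasSizeκ : Subset K → Set
  HasSizeκ S = Σ (K → Σ K S) (λ f → Injective _≡_ _≡_ f)

  Unbounded : Subset K → Set
  Unbounded S = ∀ α → ∃ (λ β → (α < β) × S β)

  Δ : (K → Subset K) → Subset K
  Δ F β = ∀ α → α < β → F α β

  record IsNormalMeasure (U : Subset K → Set) : Set₁ where
    field
      upward       : ∀ S T → U S → S ⊆ T → U T
      full         : U (λ _ → Data.Unit.⊤)
      proper       : ¬ U ∅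
      ultra        : ∀ S → U S Data.Sum.⊎ U (∁ S)
      nonprincipal : ∀ α → ¬ U (λ β → β ≡ α)
      κ-complete   : ∀ (I : Set) → SmallerThanκ I → (F : I → Subset K) →
                     (∀ i → U (F i)) → U (λ β → ∀ i → F i β)
      normal       : (F : K → Subset K) → (∀ α → U (F α)) → U (Δ F)

  -- finite partial functions from the family (indexed by K) to {0,1} = Bool
  -- (false = 0, true = 1): lists of pairs with pairwise distinct keys
  FF : Set
  FF = Σ (List (K × Bool)) (λ h → Unique (map proj₁ h))

  _⊑_ : FF → FF → Set
  (h , _) ⊑ (h' , _) = ∀ {p} → p ∈ h → p ∈ h'

  Piece : Subset K → Bool → Subset K
  Piece A' false = A'
  Piece A' true  = ∁ A'

  Cell : (K → Subset K) → FF → Subset K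
  Cell 𝒜 (h , _) β = All (λ { (i , b) → Piece (𝒜 i) b β }) h

  -- 𝒜 is a κ-independent family, 𝒜 ⊆ [κ]^κ, of cardinality κ
  -- (injectively enumerated by κ, injective up to extensional equality)
  IsIndepFamily : (K → Subset K) → Set
  IsIndepFamily 𝒜 = (∀ i → HasSizeκ (𝒜 i))
                  × (∀ i j → (∀ β → 𝒜 i β ⇔ 𝒜 j β) → i ≡ j)
                  × (∀ h → Unbounded (Cell 𝒜 h))

  InP : (U : Subset K → Set) → (K → Subset K) → Subset K → Set
  InP U 𝒜 A = IsIndepFamily 𝒜 × U A × (∀ h → Unbounded (Cell 𝒜 h ∩ A))

  InId : (U : Subset K → Set) → (K → Subset K) → Subset K → Set
  InId U 𝒜 X = U (∁ X)
             × (∀ h → Σ FF (λ h' → (h ⊑ h') × (∀ β → ¬ (Cell 𝒜 h' β × X β))))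

-- A ∖ X = A ∩ (κ ∖ X) lies in U because both A and κ ∖ X do.  Every cell 𝒜^h still
-- meets A ∖ X unboundedly: by density some refinement 𝒜^{h'} ⊆ 𝒜^h misses X
-- altogether, and 𝒜^{h'} ∩ A is unbounded because (𝒜 , A) ∈ ℙ_U.

module Submission where

open import Defs
open import Level using (0ℓ)
open import Relation.Binary.Core using (Rel)
open import Data.Bool using (Bool; true; false)
open import Data.Empty using (⊥-elim)
open import Data.Sum using (inj₁; inj₂)
open import Data.Product using (Σ; ∃; _×_; _,_; proj₁; proj₂)
open import Data.List using ([])
open import Data.List.Relation.Unary.All.Properties using (anti-mono)
import Data.List.Relation.Unary.AllPairs.Core as AllPairs
open import Relation.Binary.PropositionalEquality using (_≡_; refl; cong; sym)
open import Relation.Binary.Structures using (IsStrictTotalOrder)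
open import Relation.Nullary using (¬_)

module _ {K : Set} {_<_ : Rel K 0ℓ} where

  emptyFF : FF _<_
  emptyFF = [] , AllPairs.[]

  Cell-antitone : (𝒜 : K → Subset K) {h h' : FF _<_} →
                  _⊑_ _<_ h h' → Cell _<_ 𝒜 h' ⊆ Cell _<_ 𝒜 h
  Cell-antitone 𝒜 h⊑h' β = anti-mono h⊑h'

  unbounded-cells-∖-dense : (𝒜 : K → Subset K) {A X : Subset K} →
    (∀ h → Unbounded _<_ (Cell _<_ 𝒜 h ∩ A)) →
    (∀ h → Σ (FF _<_) λ h' → _⊑_ _<_ h h' × (∀ β → ¬ (Cell _<_ 𝒜 h' β × X β))) →
    ∀ h → Unbounded _<_ (Cell _<_ 𝒜 h ∩ (A ∖ X))
  unbounded-cells-∖-dense 𝒜 cellsA dense h α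
    with h' , h⊑h' , h'∩X≡∅ ← dense h
    with β , α<β , inCell' , inA ← cellsA h' α =
    β , α<β , Cell-antitone 𝒜 {h} {h'} h⊑h' β inCell' , inA , λ inX → h'∩X≡∅ β (inCell' , inX)

  Unbounded⇒noMaximum : {S : Subset K} → Unbounded _<_ S → ∀ α → ∃ (α <_)
  Unbounded⇒noMaximum unbounded α with β , α<β , _ ← unbounded α = β , α<β

  Bool-smallerThanκ : IsStrictTotalOrder _≡_ _<_ → (∀ α → ∃ (α <_)) →
                      K → SmallerThanκ _<_ Bool
  Bool-smallerThanκ sto noMax α₀
    with α₁ , α₀<α₁ ← noMax α₀
    with α₂ , α₁<α₂ ← noMax α₁ =
    α₂ , embed , embed-injective
    where
    open IsStrictTotalOrder sto using (irrefl; trans)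

    embed : Bool → Seg _<_ α₂
    embed false = α₀ , trans α₀<α₁ α₁<α₂
    embed true  = α₁ , α₁<α₂

    embed-injective : ∀ {b c} → embed b ≡ embed c → b ≡ c
    embed-injective {false} {false} _ = refl
    embed-injective {true}  {true}  _ = refl
    embed-injective {false} {true}  e = ⊥-elim (irrefl (cong proj₁ e) α₀<α₁)
    embed-injective {true}  {false} e = ⊥-elim (irrefl (sym (cong proj₁ e)) α₀<α₁)

-- Only ¬ ¬ K is available from the measure axioms, so κ-completeness for the
-- two-element index set is used under a double negation and then discharged
-- by the ultrafilter property.
module NormalMeasureProperties
  {K : Set} {_<_ : Rel K 0ℓ} {U : Subset K → Set} (nm : IsNormalMeasure _<_ U)
  (Bool-small : K → SmallerThanκ _<_ Bool) where

  open IsNormalMeasure nm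

  ¬¬-inhabited : ¬ ¬ K
  ¬¬-inhabited ¬K = proper (upward _ _ full λ β _ → ¬K β)

  ∩-closed-from : K → ∀ {S T} → U S → U T → U (S ∩ T)
  ∩-closed-from α {S} {T} uS uT =
    upward _ _ (κ-complete Bool (Bool-small α) pick pick∈U) λ β in-all → in-all false , in-all true
    where
    pick : Bool → Subset K
    pick false = S
    pick true  = T

    pick∈U : ∀ b → U (pick b)
    pick∈U false = uS
    pick∈U true  = uT

  ¬¬-stable : ∀ {S} → ¬ ¬ U S → U S
  ¬¬-stable {S} ¬¬uS with ultra S
  ... | inj₁ uS  = uS
  ... | inj₂ u∁S = ⊥-elim (¬¬-inhabited λ α → ¬¬uS λ uS →
                     proper (upward _ _ (∩-closed-from α uS u∁S) λ β (s , ¬s) → ¬s s))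

  ∩-closed : ∀ {S T} → U S → U T → U (S ∩ T)
  ∩-closed uS uT = ¬¬-stable λ ¬uS∩T → ¬¬-inhabited λ α → ¬uS∩T (∩-closed-from α uS uT)

mainTheorem11 : (K : Set) (_<_ : Rel K 0ℓ) → IsCardinal _<_ → Uncountable _<_ →
    (U : Subset K → Set) → IsNormalMeasure _<_ U →
    (𝒜 : K → Subset K) (A X : Subset K) →
    InP _<_ U 𝒜 A → InId _<_ U 𝒜 X → InP _<_ U 𝒜 (A ∖ X)
mainTheorem11 K _<_ (sto , _) _ U nm 𝒜 A X (indep , uA , cellsA) (u∁X , dense) =
  indep , ∩-closed uA u∁X , unbounded-cells-∖-dense 𝒜 cellsA dense
  where
  noMaximum : ∀ α → ∃ (α <_)
  noMaximum = Unbounded⇒noMaximum (proj₂ (proj₂ indep) (emptyFF {_<_ = _<_}))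

  open NormalMeasureProperties nm (Bool-smallerThanκ sto noMaximum)
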